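{- Let $\mathbf{H}=\mathbf{B}_{k,k}$ for a prime $k$, with underlying graph $H$, and let $\Psi$ be a bipartite property with $\Psi(\mathbf{B}_{k,k})\neq\Psi(\mathbf{I}_{k,k})$. Then $a_{E(H)}=\sum_{A\subseteq E(H)}\Psi(\mathbf{H}[A])\cdot(-1)^{|E(H)|-|A|}$ is non-zero.
   Context: A bipartite graph is $\mathbf{G}=(V_1,V_2,E)$ with ordered bipartition; a bipartite property is a function from bipartite graphs to $\{0,1\}$ invariant under isomorphisms that map the first part onto the first part and the second onto the second. $\mathbf{B}_{k,k}=(L,R,\{\{l,r\}:l\in L,r\in R\})$ with $|L|=|R|=k$, and $\mathbf{I}_{k,k}=(L,R,\emptyset)$ with $|L|=|R|=k$. For $A\subseteq E(\mathbf{H})$, $\mathbf{H}[A]=(V_1(\mathbf{H}),V_2(\mathbf{H}),A)$. -}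

module Defs where

open import Data.Nat using (ℕ; zero; suc; _*_; _∸_)
open import Data.Bool using (Bool; true; false; if_then_else_)
open import Data.Fin using (Fin; combine)
open import Data.Fin.Subset using (Subset; ∣_∣; inside; outside)
open import Data.Vec using (Vec; []; _∷_; lookup)
open import Data.List using (List; []; _∷_; map; _++_; foldr)
open import Data.Integer as ℤ using (ℤ; +_; -_)
open import Function.Bundles using (_↔_; Inverse)
open import Relation.Binary.PropositionalEquality using (_≡_)
open import Data.Fin.Subset using (_∈_)
open import Relation.Nullary using (does)
open import Data.Fin.Subset.Properties using (_∈?_)

record BGraph : Set where
  constructor bgraph
  field
    n₁  : ℕ
    n₂  : ℕ
    adj : Fin n₁ → Fin n₂ → Bool
open BGraph public

record BIso (G G' : BGraph) : Set where
  field
    σ₁ : Fin (n₁ G) ↔ Fin (n₁ G')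
    σ₂ : Fin (n₂ G) ↔ Fin (n₂ G')
    preserves : ∀ i j → adj G i j ≡ adj G' (Inverse.to σ₁ i) (Inverse.to σ₂ j)

record BipartiteProperty : Set where
  field
    Ψ : BGraph → Bool
    invariant : ∀ {G G'} → BIso G G' → Ψ G ≡ Ψ G'
open BipartiteProperty public

B : ℕ → BGraph
B k = bgraph k k (λ _ _ → true)

I : ℕ → BGraph
I k = bgraph k k (λ _ _ → false)

-- Edges of B_{k,k}: the pair (l , r) is encoded as  combine l r : Fin (k * k).
-- A subset A ⊆ E(B_{k,k}) is a Subset (k * k).
-- The spanning subgraph H[A] of H = B_{k,k}:
spanning : (k : ℕ) → Subset (k * k) → BGraph
spanning k A = bgraph k k (λ l r → does (combine l r ∈? A))

allSubsets : (n : ℕ) → List (Subset n)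
allSubsets zero = [] ∷ []
allSubsets (suc n) = map (inside ∷_) (allSubsets n) ++ map (outside ∷_) (allSubsets n)

toℤ : Bool → ℤ
toℤ true = + 1
toℤ false = + 0

sumℤ : List ℤ → ℤ
sumℤ = foldr ℤ._+_ (+ 0)

sign : ℕ → ℤ
sign zero = + 1
sign (suc m) = - sign m

aE : BipartiteProperty → (k : ℕ) → ℤ
aE P k = sumℤ (map (λ A → toℤ (Ψ P (spanning k A)) ℤ.* sign (k * k ∸ ∣ A ∣)) (allSubsets (k * k)))

module Submission where

-- The groups of cyclic rotations of the left and of the right part of B_{k,k} act on E(B_{k,k}),
-- hence on the subsets A indexing a_E, and they leave the summand Ψ(H[A])·(-1)^{|E|-|A|}
-- unchanged: rotating gives an isomorphic spanning subgraph with as many edges.  For a cyclic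
-- group of prime order k every orbit is a fixed point or has exactly k elements, so counting
-- each non-trivial orbit at its least element shows that a_E is congruent modulo k to the sum
-- over the subsets fixed by both rotations.  Those subsets are only ∅ and E(B_{k,k}), whose
-- terms add up to Ψ(B_{k,k}) + Ψ(I_{k,k})·(-1)^{k²} = ±1, and so a_E ≢ 0 (mod k).

open import Defs
open import Data.Nat using (ℕ)
open import Data.Nat.Primality using (Prime)
open import Data.Integer using (+_)
open import Relation.Binary.PropositionalEquality using (_≡_; _≢_)

import Algebra.Properties.CommutativeMonoid.Sum as MonoidSum
open import Data.Bool as Bool using (true; false; if_then_else_)
open import Data.Fin as Fin using (Fin; toℕ; fromℕ<; splitAt; _↑ˡ_; _↑ʳ_; combine; remQuot)
open import Data.Fin.Permutation as Perm using (Permutation; _⟨$⟩ʳ_)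
open import Data.Fin.Properties as FinP using (*↔×)
open import Data.Fin.Subset using (Subset; inside; outside; ∣_∣; ⊤; ⊥)
open import Data.Fin.Subset.Properties using (_∈?_; ∣⊤∣≡n; ∣⊥∣≡0)
open import Data.Integer as ℤ using (ℤ; 0ℤ; _+_; _*_; -_)
import Data.Integer.Properties as ℤP
open import Algebra.Properties.AbelianGroup ℤP.+-0-abelianGroup using (inverseʳ-unique)
open import Data.List as L using (List; applyUpTo)
open import Data.List.Extrema.Nat using (argmin; argmin-all; f[argmin]≤f[xs])
open import Data.List.Membership.Propositional.Properties using (∈-applyUpTo⁺)
import Data.List.Properties as LP
import Data.List.Relation.Unary.All as All
open import Data.List.Relation.Unary.All.Properties using (applyUpTo⁺₁)
open import Data.Nat as ℕ using (zero; suc; pred; _∸_; _<_; _≤_; NonZero)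
open import Data.Nat.Coprimality using (Coprime; coprime-Bézout; prime⇒coprime)
open import Data.Nat.DivMod
  using (_%_; _/_; _mod_; m≡m%n+[m/n]*n; m%n<n; m<n⇒m%n≡m; m%n%n≡m%n; [m+n]%n≡m%n; %-distribˡ-+)
open import Data.Nat.GCD using (module Bézout)
open import Data.Nat.Primality using (prime⇒nonZero; prime⇒nonTrivial)
import Data.Nat.Properties as ℕP
open import Data.Product as Product using (∃-syntax; _×_; _,_; uncurry)
open import Data.Product.Function.NonDependent.Propositional using (_×-↔_)
open import Data.Sum using (_⊎_; inj₁; inj₂; [_,_]′)
open import Data.Vec using ([]; _∷_; lookup; tabulate; replicate)
open import Data.Vec.Properties as VecP
  using (lookup∘tabulate; tabulate∘lookup; tabulate-cong; lookup-replicate)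
open import Function using (_∘_; const; Inverse; _↔_; mk↔ₛ′)
import Function.Endo.Propositional as Endo
open import Function.Properties.Inverse using (↔-trans; ↔-sym)
open import Level using (0ℓ)
open import Relation.Binary using (DecidableEquality; tri<; tri≈; tri>)
open import Relation.Binary.PropositionalEquality
  using (refl; sym; trans; cong; cong₂; subst; module ≡-Reasoning)
open import Relation.Nullary using (¬_; Dec; does; yes; no; contradiction)
open import Relation.Nullary.Decidable using (¬?)
open import Relation.Unary using (Pred; Decidable)

open MonoidSum ℤP.+-0-commutativeMonoid
  using (sum; sum-cong-≗; ∑-comm; ∑-distrib-+; sum-permute; sum-replicate-zero)
open ≡-Reasoning

_^_ : {A : Set} → (A → A) → ℕ → A → A
_^_ {A} = Endo._^_ A

module _ {A : Set} (f : A → A) where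

  ^-+ : ∀ m n x → (f ^ (m ℕ.+ n)) x ≡ (f ^ m) ((f ^ n) x)
  ^-+ m n x = cong (λ h → h x) (Endo.^-homo A f m n)

  ^-sucʳ : ∀ n x → (f ^ suc n) x ≡ (f ^ n) (f x)
  ^-sucʳ n x = trans (cong (λ m → (f ^ m) x) (ℕP.+-comm 1 n)) (^-+ n 1 x)

  ^-pred : ∀ n .{{_ : NonZero n}} x → (f ^ n) x ≡ (f ^ pred n) (f x)
  ^-pred n x = trans (cong (λ m → (f ^ m) x) (sym (ℕP.suc-pred n))) (^-sucʳ (pred n) x)

  fixed⇒^-fixed : ∀ {x} → f x ≡ x → ∀ n → (f ^ n) x ≡ x
  fixed⇒^-fixed fx≡x zero    = refl
  fixed⇒^-fixed fx≡x (suc n) = trans (cong f (fixed⇒^-fixed fx≡x n)) fx≡x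

  ^-*-fixed : ∀ {x d} → (f ^ d) x ≡ x → ∀ t → (f ^ (t ℕ.* d)) x ≡ x
  ^-*-fixed e zero            = refl
  ^-*-fixed {x} {d} e (suc t) =
    trans (^-+ d (t ℕ.* d) x) (trans (cong (f ^ d) (^-*-fixed e t)) e)

  ^-mod : ∀ {x} p .{{_ : NonZero p}} → (f ^ p) x ≡ x → ∀ n → (f ^ n) x ≡ (f ^ (n % p)) x
  ^-mod {x} p e n = begin
    (f ^ n) x                             ≡⟨ cong (λ m → (f ^ m) x) (m≡m%n+[m/n]*n n p) ⟩
    (f ^ (n % p ℕ.+ n / p ℕ.* p)) x       ≡⟨ ^-+ (n % p) (n / p ℕ.* p) x ⟩
    (f ^ (n % p)) ((f ^ (n / p ℕ.* p)) x) ≡⟨ cong (f ^ (n % p)) (^-*-fixed e (n / p)) ⟩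
    (f ^ (n % p)) x                       ∎

  coprime-periods⇒fixed : ∀ {x p d} → Coprime p d → (f ^ p) x ≡ x → (f ^ d) x ≡ x → f x ≡ x
  coprime-periods⇒fixed {x} {p} {d} c ep ed with coprime-Bézout c
  ... | Bézout.+- a b eq = begin
    f x                    ≡⟨ cong f (^-*-fixed ed b) ⟨
    (f ^ suc (b ℕ.* d)) x  ≡⟨ cong (λ m → (f ^ m) x) eq ⟩
    (f ^ (a ℕ.* p)) x      ≡⟨ ^-*-fixed ep a ⟩
    x                      ∎
  ... | Bézout.-+ a b eq = begin
    f x                    ≡⟨ cong f (^-*-fixed ep a) ⟨
    (f ^ suc (a ℕ.* p)) x  ≡⟨ cong (λ m → (f ^ m) x) eq ⟩
    (f ^ (b ℕ.* d)) x      ≡⟨ ^-*-fixed ed b ⟩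
    x                      ∎

  module _ {p} .{{_ : NonZero p}} (f^p≗id : ∀ x → (f ^ p) x ≡ x) where

    periodic⇒injective : ∀ {x y} → f x ≡ f y → x ≡ y
    periodic⇒injective {x} {y} fx≡fy = begin
      x                  ≡⟨ f^p≗id x ⟨
      (f ^ p) x          ≡⟨ ^-pred p x ⟩
      (f ^ pred p) (f x) ≡⟨ cong (f ^ pred p) fx≡fy ⟩
      (f ^ pred p) (f y) ≡⟨ ^-pred p y ⟨
      (f ^ p) y          ≡⟨ f^p≗id y ⟩
      y                  ∎

    periodic⇒^-injective : ∀ n {x y} → (f ^ n) x ≡ (f ^ n) y → x ≡ y
    periodic⇒^-injective zero    e = e
    periodic⇒^-injective (suc n) e = periodic⇒^-injective n (periodic⇒injective e)

    periodic⇒↔ : A ↔ A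
    periodic⇒↔ = mk↔ₛ′ f (f ^ pred p)
      (λ x → trans (cong (λ m → (f ^ m) x) (ℕP.suc-pred p)) (f^p≗id x))
      (λ x → trans (sym (^-pred p x)) (f^p≗id x))

module _ {A B : Set} {f : A → A} {h : A → B} (h∘f≗h : ∀ x → h (f x) ≡ h x) where

  invariant⇒^-invariant : ∀ n x → h ((f ^ n) x) ≡ h x
  invariant⇒^-invariant zero    x = refl
  invariant⇒^-invariant (suc n) x = trans (h∘f≗h ((f ^ n) x)) (invariant⇒^-invariant n x)

infix 4 _≡_[mod_]

record _≡_[mod_] (x y : ℤ) (p : ℕ) : Set where
  constructor quotient
  field
    q      : ℤ
    x≡y+pq : x ≡ y + + p * q

≡-mod-reflexive : ∀ {x y p} → x ≡ y → x ≡ y [mod p ]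
≡-mod-reflexive {x} {y} {p} x≡y = quotient 0ℤ (begin
  x             ≡⟨ x≡y ⟩
  y             ≡⟨ ℤP.+-identityʳ y ⟨
  y + 0ℤ        ≡⟨ cong (_+_ y) (ℤP.*-zeroʳ (+ p)) ⟨
  y + + p * 0ℤ  ∎)

≡-mod-trans : ∀ {x y z p} → x ≡ y [mod p ] → y ≡ z [mod p ] → x ≡ z [mod p ]
≡-mod-trans {x} {y} {z} {p} (quotient q₁ x≡y+pq₁) (quotient q₂ y≡z+pq₂) = quotient (q₂ + q₁) (begin
  x                          ≡⟨ x≡y+pq₁ ⟩
  y + + p * q₁               ≡⟨ cong (λ w → w + + p * q₁) y≡z+pq₂ ⟩
  z + + p * q₂ + + p * q₁    ≡⟨ ℤP.+-assoc z (+ p * q₂) (+ p * q₁) ⟩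
  z + (+ p * q₂ + + p * q₁)  ≡⟨ cong (_+_ z) (ℤP.*-distribˡ-+ (+ p) q₂ q₁) ⟨
  z + + p * (q₂ + q₁)        ∎)

unit-mod⇒≢0 : ∀ {x u p} → 1 < p → ℤ.∣ u ∣ ≡ 1 → x ≡ u [mod p ] → x ≢ 0ℤ
unit-mod⇒≢0 {x} {u} {p} 1<p ∣u∣≡1 (quotient q x≡u+pq) x≡0 =
  ℕP.<⇒≢ 1<p (sym (ℕP.m*n≡1⇒m≡1 p ℤ.∣ q ∣ (begin
    p ℕ.* ℤ.∣ q ∣  ≡⟨ ℤP.abs-* (+ p) q ⟨
    ℤ.∣ + p * q ∣  ≡⟨ cong ℤ.∣_∣ (inverseʳ-unique u (+ p * q) (trans (sym x≡u+pq) x≡0)) ⟩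
    ℤ.∣ - u ∣      ≡⟨ ℤP.∣-i∣≡∣i∣ u ⟩
    ℤ.∣ u ∣        ≡⟨ ∣u∣≡1 ⟩
    1              ∎)))

sum-const : ∀ n c → sum {n} (const c) ≡ + n * c
sum-const zero    c = sym (ℤP.*-zeroˡ c)
sum-const (suc n) c = begin
  c + sum {n} (const c)  ≡⟨ cong (_+_ c) (sum-const n c) ⟩
  c + + n * c            ≡⟨ cong (λ z → z + + n * c) (ℤP.*-identityˡ c) ⟨
  + 1 * c + + n * c      ≡⟨ ℤP.*-distribʳ-+ c (+ 1) (+ n) ⟨
  + suc n * c            ∎

sum-↑ : ∀ m n (f : Fin (m ℕ.+ n) → ℤ) → sum f ≡ sum (f ∘ (_↑ˡ n)) + sum (f ∘ (m ↑ʳ_))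
sum-↑ zero    n f = sym (ℤP.+-identityˡ (sum f))
sum-↑ (suc m) n f = trans (cong (_+_ (f Fin.zero)) (sum-↑ m n (f ∘ Fin.suc)))
  (sym (ℤP.+-assoc (f Fin.zero) _ _))

restrict : {A : Set} {P : Pred A 0ℓ} → Decidable P → (A → ℤ) → A → ℤ
restrict P? f x = if does (P? x) then f x else 0ℤ

module _ {A : Set} {P : Pred A 0ℓ} (P? : Decidable P) where

  restrict-∈ : ∀ f x → P x → restrict P? f x ≡ f x
  restrict-∈ f x px with P? x
  ... | yes _  = refl
  ... | no ¬px = contradiction px ¬px

  restrict-∉ : ∀ f x → ¬ P x → restrict P? f x ≡ 0ℤ
  restrict-∉ f x ¬px with P? x
  ... | yes px = contradiction px ¬px
  ... | no _   = refl

  restrict-zero : ∀ f x → f x ≡ 0ℤ → restrict P? f x ≡ 0ℤ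
  restrict-zero f x fx≡0 with P? x
  ... | yes _ = fx≡0
  ... | no _  = refl

  restrict-split : ∀ f x → f x ≡ restrict P? f x + restrict (¬? ∘ P?) f x
  restrict-split f x with P? x
  ... | yes _ = sym (ℤP.+-identityʳ (f x))
  ... | no _  = sym (ℤP.+-identityˡ (f x))

  module _ {B : Set} {Q : Pred B 0ℓ} (Q? : Decidable Q) where

    restrict-cong : ∀ f g x y → (P x → Q y) → (Q y → P x) → f x ≡ g y →
                    restrict P? f x ≡ restrict Q? g y
    restrict-cong f g x y P⇒Q Q⇒P fx≡gy with P? x | Q? y
    ... | yes _  | yes _  = fx≡gy
    ... | yes px | no ¬qy = contradiction (P⇒Q px) ¬qy
    ... | no ¬px | yes qy = contradiction (Q⇒P qy) ¬px
    ... | no _   | no _   = refl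

sum-restrict-unique : ∀ {n} {P : Pred (Fin n) 0ℓ} (P? : Decidable P) v {i₀} →
                      P i₀ → (∀ {i} → P i → i ≡ i₀) → sum (restrict P? (const v)) ≡ v
sum-restrict-unique {suc n} P? v {Fin.zero} p₀ unique = begin
  restrict P? (const v) Fin.zero + sum (restrict P? (const v) ∘ Fin.suc)
    ≡⟨ cong₂ _+_ (restrict-∈ P? (const v) Fin.zero p₀)
                 (sum-cong-≗ (λ i → restrict-∉ P? (const v) (Fin.suc i) (FinP.0≢1+n ∘ sym ∘ unique))) ⟩
  v + sum {n} (const 0ℤ)  ≡⟨ cong (_+_ v) (sum-replicate-zero n) ⟩
  v + 0ℤ                  ≡⟨ ℤP.+-identityʳ v ⟩
  v                       ∎
sum-restrict-unique {suc n} P? v {Fin.suc i₀} p₀ unique = begin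
  restrict P? (const v) Fin.zero + sum (restrict P? (const v) ∘ Fin.suc)
    ≡⟨ cong₂ _+_ (restrict-∉ P? (const v) Fin.zero (FinP.0≢1+n ∘ unique))
                 (sum-restrict-unique (P? ∘ Fin.suc) v p₀ (FinP.suc-injective ∘ unique)) ⟩
  0ℤ + v  ≡⟨ ℤP.+-identityˡ v ⟩
  v       ∎

module _ {X : Set} {N : ℕ} (enum : Fin N ↔ X) where

  open Inverse enum using (to; from; strictlyInverseˡ; strictlyInverseʳ)

  ∑ : (X → ℤ) → ℤ
  ∑ f = sum (f ∘ to)

  ∑-cong : ∀ {f g} → (∀ x → f x ≡ g x) → ∑ f ≡ ∑ g
  ∑-cong f≗g = sum-cong-≗ (f≗g ∘ to)

  ∑-distrib : ∀ f g → ∑ (λ x → f x + g x) ≡ ∑ f + ∑ g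
  ∑-distrib f g = ∑-distrib-+ (f ∘ to) (g ∘ to)

  ∑-∘-↔ : ∀ (π : X ↔ X) f → ∑ (f ∘ Inverse.to π) ≡ ∑ f
  ∑-∘-↔ π f = sym (trans (sum-permute (f ∘ to) (↔-trans enum (↔-trans π (↔-sym enum))))
    (sum-cong-≗ (λ i → cong f (strictlyInverseˡ (Inverse.to π (to i))))))

  ∑-single : ∀ {_≟_ : DecidableEquality X} a v → ∑ (restrict (_≟ a) (const v)) ≡ v
  ∑-single {_≟_} a v = sum-restrict-unique (λ i → to i ≟ a) v (strictlyInverseˡ a)
    (λ {i} toi≡a → trans (sym (strictlyInverseʳ i)) (cong from toi≡a))

module _ {X : Set} (_≟_ : DecidableEquality X) where

  fixed? : (g : X → X) → Decidable (λ x → g x ≡ x)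
  fixed? g x = g x ≟ x

  fixedPart : (X → X) → (X → ℤ) → X → ℤ
  fixedPart g = restrict (fixed? g)

  module _ {g h : X → X} (h-injective : ∀ {x y} → h x ≡ h y → x ≡ y)
           (gh≗hg : ∀ x → g (h x) ≡ h (g x)) where

    fixed-invariantˡ : ∀ {x} → g (h x) ≡ h x → g x ≡ x
    fixed-invariantˡ {x} e = h-injective (trans (sym (gh≗hg x)) e)

    fixed-invariantʳ : ∀ {x} → g x ≡ x → g (h x) ≡ h x
    fixed-invariantʳ {x} e = trans (gh≗hg x) (cong h e)

    fixedPart-invariant : ∀ {f} → (∀ x → f (h x) ≡ f x) → ∀ x → fixedPart g f (h x) ≡ fixedPart g f x
    fixedPart-invariant {f} f∘h≗f x =
      restrict-cong (fixed? g) (fixed? g) f f (h x) x fixed-invariantˡ fixed-invariantʳ (f∘h≗f x)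

  module _ {g h : X → X} {f : X → ℤ} {x : X} where

    fixedPart-fixedPart-fixed : g x ≡ x → h x ≡ x → fixedPart h (fixedPart g f) x ≡ f x
    fixedPart-fixedPart-fixed gx≡x hx≡x =
      trans (restrict-∈ (fixed? h) (fixedPart g f) x hx≡x) (restrict-∈ (fixed? g) f x gx≡x)

    fixedPart-fixedPart-moved : ¬ (g x ≡ x × h x ≡ x) → fixedPart h (fixedPart g f) x ≡ 0ℤ
    fixedPart-fixedPart-moved ¬both with fixed? h x
    ... | yes hx≡x = restrict-∉ (fixed? g) f x (λ gx≡x → ¬both (gx≡x , hx≡x))
    ... | no _     = refl

module Orbits {X : Set} {N : ℕ} (enum : Fin N ↔ X) (_≟_ : DecidableEquality X)
  {p : ℕ} (p-prime : Prime p) (g : X → X) (g^p≗id : ∀ x → (g ^ p) x ≡ x) where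

  open Inverse enum using (to; from; strictlyInverseˡ)

  private instance
    p≢0 : NonZero p
    p≢0 = prime⇒nonZero p-prime

  g-injective : ∀ {x y} → g x ≡ g y → x ≡ y
  g-injective = periodic⇒injective g g^p≗id

  ∑-^ : ∀ j f → ∑ enum (f ∘ g ^ j) ≡ ∑ enum f
  ∑-^ zero    f = refl
  ∑-^ (suc j) f = trans (∑-^ j (f ∘ g)) (∑-∘-↔ enum (periodic⇒↔ g g^p≗id) f)

  ^-fixed⇒fixed : ∀ {x d} → 0 < d → d < p → (g ^ d) x ≡ x → g x ≡ x
  ^-fixed⇒fixed 0<d d<p =
    coprime-periods⇒fixed g (prime⇒coprime p-prime {{ℕ.>-nonZero 0<d}} d<p) (g^p≗id _)

  ^-collision⇒fixed : ∀ {x a b} → a < b → b < p → (g ^ a) x ≡ (g ^ b) x → g x ≡ x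
  ^-collision⇒fixed {x} {a} {b} a<b b<p e =
    ^-fixed⇒fixed (ℕP.m<n⇒0<n∸m a<b) (ℕP.≤-<-trans (ℕP.m∸n≤m b a) b<p)
      (periodic⇒^-injective g g^p≗id a (sym (begin
        (g ^ a) x                  ≡⟨ e ⟩
        (g ^ b) x                  ≡⟨ cong (λ m → (g ^ m) x) (ℕP.m+[n∸m]≡n (ℕP.<⇒≤ a<b)) ⟨
        (g ^ (a ℕ.+ (b ∸ a))) x    ≡⟨ ^-+ g a (b ∸ a) x ⟩
        (g ^ a) ((g ^ (b ∸ a)) x)  ∎)))

  ^-exponent-unique : ∀ {x a b} → g x ≢ x → a < p → b < p → (g ^ a) x ≡ (g ^ b) x → a ≡ b
  ^-exponent-unique moved a<p b<p e with ℕP.<-cmp _ _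
  ... | tri< a<b _ _ = contradiction (^-collision⇒fixed a<b b<p e) moved
  ... | tri≈ _ a≡b _ = a≡b
  ... | tri> _ _ b<a = contradiction (^-collision⇒fixed b<a a<p (sym e)) moved

  key : X → ℕ
  key = toℕ ∘ from

  key-injective : ∀ {x y} → key x ≡ key y → x ≡ y
  key-injective {x} {y} e = begin
    x            ≡⟨ strictlyInverseˡ x ⟨
    to (from x)  ≡⟨ cong to (FinP.toℕ-injective e) ⟩
    to (from y)  ≡⟨ strictlyInverseˡ y ⟩
    y            ∎

  orbit : X → List X
  orbit x = applyUpTo (λ j → (g ^ j) x) p

  orbitMin : X → X
  orbitMin x = argmin key x (orbit x)

  orbitMin-∈ : ∀ x → ∃[ j ] j < p × orbitMin x ≡ (g ^ j) x
  orbitMin-∈ x = argmin-all key {P = λ y → ∃[ j ] j < p × y ≡ (g ^ j) x}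
    (0 , ℕ.>-nonZero⁻¹ p , refl) (applyUpTo⁺₁ (λ j → (g ^ j) x) p (λ {j} j<p → j , j<p , refl))

  orbitMin-≤ : ∀ x j → key (orbitMin x) ≤ key ((g ^ j) x)
  orbitMin-≤ x j = ℕP.≤-trans
    (All.lookup (f[argmin]≤f[xs] {f = key} x (orbit x)) (∈-applyUpTo⁺ (λ j → (g ^ j) x) (m%n<n j p)))
    (ℕP.≤-reflexive (cong key (sym (^-mod g p (g^p≗id x) j))))

  orbitMin-g : ∀ x → orbitMin (g x) ≡ orbitMin x
  orbitMin-g x with orbitMin-∈ x | orbitMin-∈ (g x)
  ... | a , _ , min≡gᵃx | b , _ , min≡gᵇgx = key-injective (ℕP.≤-antisym
    (ℕP.≤-trans (orbitMin-≤ (g x) (a ℕ.+ pred p)) (ℕP.≤-reflexive (cong key (begin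
      (g ^ (a ℕ.+ pred p)) (g x)    ≡⟨ ^-+ g a (pred p) (g x) ⟩
      (g ^ a) ((g ^ pred p) (g x))  ≡⟨ cong (g ^ a) (^-pred g p x) ⟨
      (g ^ a) ((g ^ p) x)           ≡⟨ cong (g ^ a) (g^p≗id x) ⟩
      (g ^ a) x                     ≡⟨ min≡gᵃx ⟨
      orbitMin x                    ∎))))
    (ℕP.≤-trans (orbitMin-≤ x (suc b)) (ℕP.≤-reflexive (cong key (begin
      (g ^ suc b) x                 ≡⟨ ^-sucʳ g b x ⟩
      (g ^ b) (g x)                 ≡⟨ min≡gᵇgx ⟨
      orbitMin (g x)                ∎)))))

  orbitMin-^ : ∀ j x → orbitMin ((g ^ j) x) ≡ orbitMin x
  orbitMin-^ = invariant⇒^-invariant orbitMin-g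

  isOrbitMin? : Decidable (λ x → x ≡ orbitMin x)
  isOrbitMin? x = x ≟ orbitMin x

  onOrbitMin : (X → ℤ) → X → ℤ
  onOrbitMin = restrict isOrbitMin?

  module _ {h : X → ℤ} (h∘g≗h : ∀ x → h (g x) ≡ h x) (h-fixed : ∀ {x} → g x ≡ x → h x ≡ 0ℤ) where

    sum-orbit : ∀ x → sum (λ (j : Fin p) → onOrbitMin h ((g ^ toℕ j) x)) ≡ h x
    sum-orbit x with g x ≟ x
    ... | yes gx≡x = begin
      sum {p} (λ j → onOrbitMin h ((g ^ toℕ j) x))
        ≡⟨ sum-cong-≗ {p} (λ j → restrict-zero isOrbitMin? h ((g ^ toℕ j) x)
             (trans (invariant⇒^-invariant h∘g≗h (toℕ j) x) (h-fixed gx≡x))) ⟩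
      sum {p} (const 0ℤ)  ≡⟨ sum-replicate-zero p ⟩
      0ℤ                  ≡⟨ h-fixed gx≡x ⟨
      h x                 ∎
    ... | no gx≢x with orbitMin-∈ x
    ... | a , a<p , min≡gᵃx = begin
      sum {p} (λ j → onOrbitMin h ((g ^ toℕ j) x))
        ≡⟨ sum-cong-≗ (λ j → restrict-cong isOrbitMin? hits-min h (const (h x)) ((g ^ toℕ j) x) j
             (λ e → trans e (orbitMin-^ (toℕ j) x)) (λ e → trans e (sym (orbitMin-^ (toℕ j) x)))
             (invariant⇒^-invariant h∘g≗h (toℕ j) x)) ⟩
      sum (restrict hits-min (const (h x)))
        ≡⟨ sum-restrict-unique hits-min (h x) hit hit-unique ⟩
      h x ∎
      where
      hits-min : Decidable (λ (j : Fin p) → (g ^ toℕ j) x ≡ orbitMin x)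
      hits-min j = (g ^ toℕ j) x ≟ orbitMin x

      hit : (g ^ toℕ (fromℕ< a<p)) x ≡ orbitMin x
      hit = trans (cong (λ m → (g ^ m) x) (FinP.toℕ-fromℕ< a<p)) (sym min≡gᵃx)

      hit-unique : ∀ {j} → (g ^ toℕ j) x ≡ orbitMin x → j ≡ fromℕ< a<p
      hit-unique {j} e = FinP.toℕ-injective (trans
        (^-exponent-unique gx≢x (FinP.toℕ<n j) a<p (trans e min≡gᵃx))
        (sym (FinP.toℕ-fromℕ< a<p)))

    ∑-orbits : ∑ enum h ≡ + p * ∑ enum (onOrbitMin h)
    ∑-orbits = begin
      ∑ enum h
        ≡⟨ ∑-cong enum sum-orbit ⟨
      ∑ enum (λ x → sum (λ (j : Fin p) → onOrbitMin h ((g ^ toℕ j) x)))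
        ≡⟨ ∑-comm (λ i (j : Fin p) → onOrbitMin h ((g ^ toℕ j) (to i))) ⟩
      sum (λ (j : Fin p) → ∑ enum (onOrbitMin h ∘ g ^ toℕ j))
        ≡⟨ sum-cong-≗ {p} (λ j → ∑-^ (toℕ j) (onOrbitMin h)) ⟩
      sum {p} (const (∑ enum (onOrbitMin h)))
        ≡⟨ sum-const p _ ⟩
      + p * ∑ enum (onOrbitMin h) ∎

  movedPart : (X → ℤ) → X → ℤ
  movedPart = restrict (¬? ∘ fixed? _≟_ g)

  ∑-fixedPart : ∀ {f} → (∀ x → f (g x) ≡ f x) → ∑ enum f ≡ ∑ enum (fixedPart _≟_ g f) [mod p ]
  ∑-fixedPart {f} f∘g≗f = quotient (∑ enum (onOrbitMin (movedPart f))) (begin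
    ∑ enum f
      ≡⟨ ∑-cong enum (restrict-split (fixed? _≟_ g) f) ⟩
    ∑ enum (λ x → fixedPart _≟_ g f x + movedPart f x)
      ≡⟨ ∑-distrib enum (fixedPart _≟_ g f) (movedPart f) ⟩
    ∑ enum (fixedPart _≟_ g f) + ∑ enum (movedPart f)
      ≡⟨ cong (_+_ (∑ enum (fixedPart _≟_ g f))) (∑-orbits moved-invariant moved-vanishes) ⟩
    ∑ enum (fixedPart _≟_ g f) + + p * ∑ enum (onOrbitMin (movedPart f)) ∎)
    where
    moved-invariant : ∀ x → movedPart f (g x) ≡ movedPart f x
    moved-invariant x = restrict-cong (¬? ∘ fixed? _≟_ g) (¬? ∘ fixed? _≟_ g) f f (g x) x
      (λ ¬fixed fixed → ¬fixed (fixed-invariantʳ _≟_ {g} g-injective (λ _ → refl) fixed))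
      (λ ¬fixed fixed → ¬fixed (fixed-invariantˡ _≟_ {g} g-injective (λ _ → refl) fixed))
      (f∘g≗f x)

    moved-vanishes : ∀ {x} → g x ≡ x → movedPart f x ≡ 0ℤ
    moved-vanishes fixed = restrict-∉ (¬? ∘ fixed? _≟_ g) f _ (λ ¬fixed → ¬fixed fixed)

-- 2ⁿ as a sum, so that splitAt separates the subsets containing 0 from the others.
pow2 : ℕ → ℕ
pow2 zero    = 1
pow2 (suc n) = pow2 n ℕ.+ pow2 n

subsetAt : ∀ n → Fin (pow2 n) → Subset n
subsetAt zero    _ = []
subsetAt (suc n) i = [ (inside ∷_) ∘ subsetAt n , (outside ∷_) ∘ subsetAt n ]′ (splitAt (pow2 n) i)

subsetAt-↑ˡ : ∀ n i → subsetAt (suc n) (i ↑ˡ pow2 n) ≡ inside ∷ subsetAt n i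
subsetAt-↑ˡ n i rewrite FinP.splitAt-↑ˡ (pow2 n) i (pow2 n) = refl

subsetAt-↑ʳ : ∀ n i → subsetAt (suc n) (pow2 n ↑ʳ i) ≡ outside ∷ subsetAt n i
subsetAt-↑ʳ n i rewrite FinP.splitAt-↑ʳ (pow2 n) (pow2 n) i = refl

indexOf : ∀ {n} → Subset n → Fin (pow2 n)
indexOf []                    = Fin.zero
indexOf {suc n} (inside ∷ A)  = indexOf A ↑ˡ pow2 n
indexOf {suc n} (outside ∷ A) = pow2 n ↑ʳ indexOf A

subsetAt-indexOf : ∀ {n} (A : Subset n) → subsetAt n (indexOf A) ≡ A
subsetAt-indexOf []                    = refl
subsetAt-indexOf {suc n} (inside ∷ A)  =
  trans (subsetAt-↑ˡ n (indexOf A)) (cong (inside ∷_) (subsetAt-indexOf A))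
subsetAt-indexOf {suc n} (outside ∷ A) =
  trans (subsetAt-↑ʳ n (indexOf A)) (cong (outside ∷_) (subsetAt-indexOf A))

indexOf-subsetAt : ∀ n i → indexOf (subsetAt n i) ≡ i
indexOf-subsetAt zero    Fin.zero = refl
indexOf-subsetAt (suc n) i with splitAt (pow2 n) i in eq
... | inj₁ j = trans (cong (_↑ˡ pow2 n) (indexOf-subsetAt n j)) (FinP.splitAt⁻¹-↑ˡ eq)
... | inj₂ j = trans (cong (pow2 n ↑ʳ_) (indexOf-subsetAt n j)) (FinP.splitAt⁻¹-↑ʳ eq)

enumSubsets : ∀ n → Fin (pow2 n) ↔ Subset n
enumSubsets n = mk↔ₛ′ (subsetAt n) indexOf subsetAt-indexOf (indexOf-subsetAt n)

sumℤ-++ : ∀ xs ys → sumℤ (xs L.++ ys) ≡ sumℤ xs + sumℤ ys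
sumℤ-++ L.[]       ys = sym (ℤP.+-identityˡ (sumℤ ys))
sumℤ-++ (x L.∷ xs) ys = trans (cong (_+_ x) (sumℤ-++ xs ys)) (sym (ℤP.+-assoc x (sumℤ xs) (sumℤ ys)))

sum-allSubsets : ∀ n (F : Subset n → ℤ) → sumℤ (L.map F (allSubsets n)) ≡ ∑ (enumSubsets n) F
sum-allSubsets zero    F = refl
sum-allSubsets (suc n) F = begin
  sumℤ (L.map F (L.map (inside ∷_) S L.++ L.map (outside ∷_) S))
    ≡⟨ cong sumℤ (LP.map-++ F (L.map (inside ∷_) S) (L.map (outside ∷_) S)) ⟩
  sumℤ (L.map F (L.map (inside ∷_) S) L.++ L.map F (L.map (outside ∷_) S))
    ≡⟨ sumℤ-++ (L.map F (L.map (inside ∷_) S)) (L.map F (L.map (outside ∷_) S)) ⟩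
  sumℤ (L.map F (L.map (inside ∷_) S)) + sumℤ (L.map F (L.map (outside ∷_) S))
    ≡⟨ cong₂ _+_ (cong sumℤ (sym (LP.map-∘ S))) (cong sumℤ (sym (LP.map-∘ S))) ⟩
  sumℤ (L.map (F ∘ (inside ∷_)) S) + sumℤ (L.map (F ∘ (outside ∷_)) S)
    ≡⟨ cong₂ _+_ (sum-allSubsets n (F ∘ (inside ∷_))) (sum-allSubsets n (F ∘ (outside ∷_))) ⟩
  sum (F ∘ (inside ∷_) ∘ subsetAt n) + sum (F ∘ (outside ∷_) ∘ subsetAt n)
    ≡⟨ cong₂ _+_ (sum-cong-≗ (cong F ∘ subsetAt-↑ˡ n)) (sum-cong-≗ (cong F ∘ subsetAt-↑ʳ n)) ⟨
  sum (F ∘ subsetAt (suc n) ∘ (_↑ˡ pow2 n)) + sum (F ∘ subsetAt (suc n) ∘ (pow2 n ↑ʳ_))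
    ≡⟨ sum-↑ (pow2 n) (pow2 n) (F ∘ subsetAt (suc n)) ⟨
  sum (F ∘ subsetAt (suc n)) ∎
  where S = allSubsets n

_≟ˢ_ : ∀ {m} → DecidableEquality (Subset m)
_≟ˢ_ = VecP.≡-dec Bool._≟_

does-∈? : ∀ {n} (x : Fin n) (A : Subset n) → does (x ∈? A) ≡ lookup A x
does-∈? Fin.zero    (inside ∷ A)  = refl
does-∈? Fin.zero    (outside ∷ A) = refl
does-∈? (Fin.suc x) (_ ∷ A)       = does-∈? x A

+∣∣≡sum : ∀ {n} (A : Subset n) → + ∣ A ∣ ≡ sum (toℤ ∘ lookup A)
+∣∣≡sum []            = refl
+∣∣≡sum (inside ∷ A)  = cong (_+_ (+ 1)) (+∣∣≡sum A)
+∣∣≡sum (outside ∷ A) = trans (+∣∣≡sum A) (sym (ℤP.+-identityˡ _))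

∣∣-permute : ∀ {n} (π : Permutation n n) (A : Subset n) →
             ∣ tabulate (lookup A ∘ (π ⟨$⟩ʳ_)) ∣ ≡ ∣ A ∣
∣∣-permute π A = ℤP.+-injective (begin
  + ∣ tabulate (lookup A ∘ (π ⟨$⟩ʳ_)) ∣
    ≡⟨ +∣∣≡sum (tabulate (lookup A ∘ (π ⟨$⟩ʳ_))) ⟩
  sum (toℤ ∘ lookup (tabulate (lookup A ∘ (π ⟨$⟩ʳ_))))
    ≡⟨ sum-cong-≗ (cong toℤ ∘ lookup∘tabulate (lookup A ∘ (π ⟨$⟩ʳ_))) ⟩
  sum (toℤ ∘ lookup A ∘ (π ⟨$⟩ʳ_))
    ≡⟨ sum-permute (toℤ ∘ lookup A) π ⟨
  sum (toℤ ∘ lookup A)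
    ≡⟨ +∣∣≡sum A ⟨
  + ∣ A ∣ ∎)

module _ {k : ℕ} where

  _⊗_ : Permutation k k → Permutation k k → Permutation (k ℕ.* k) (k ℕ.* k)
  σ ⊗ τ = ↔-trans *↔× (↔-trans (σ ×-↔ τ) (↔-sym *↔×))

  ⊗-combine : ∀ σ τ (l r : Fin k) → (σ ⊗ τ) ⟨$⟩ʳ combine l r ≡ combine (σ ⟨$⟩ʳ l) (τ ⟨$⟩ʳ r)
  ⊗-combine σ τ l r =
    cong (uncurry combine ∘ Product.map (σ ⟨$⟩ʳ_) (τ ⟨$⟩ʳ_)) (FinP.remQuot-combine l r)

  relabel : Permutation k k → Permutation k k → Subset (k ℕ.* k) → Subset (k ℕ.* k)
  relabel σ τ A = tabulate (lookup A ∘ ((σ ⊗ τ) ⟨$⟩ʳ_))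

  lookup-relabel : ∀ σ τ A (l r : Fin k) →
                   lookup (relabel σ τ A) (combine l r) ≡ lookup A (combine (σ ⟨$⟩ʳ l) (τ ⟨$⟩ʳ r))
  lookup-relabel σ τ A l r =
    trans (lookup∘tabulate _ (combine l r)) (cong (lookup A) (⊗-combine σ τ l r))

  edge-ext : ∀ {A B : Subset (k ℕ.* k)} →
             (∀ (l r : Fin k) → lookup A (combine l r) ≡ lookup B (combine l r)) → A ≡ B
  edge-ext {A} {B} A≗B = begin
    A                    ≡⟨ tabulate∘lookup A ⟨
    tabulate (lookup A)  ≡⟨ tabulate-cong lookup-≗ ⟩
    tabulate (lookup B)  ≡⟨ tabulate∘lookup B ⟩
    B                    ∎
    where
    lookup-≗ : ∀ e → lookup A e ≡ lookup B e
    lookup-≗ e = subst (λ e → lookup A e ≡ lookup B e) (FinP.combine-remQuot {k} k e)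
                       (uncurry A≗B (remQuot k e))

  relabel-replicate : ∀ σ τ b → relabel σ τ (replicate (k ℕ.* k) b) ≡ replicate (k ℕ.* k) b
  relabel-replicate σ τ b = edge-ext λ l r → begin
    lookup (relabel σ τ (replicate (k ℕ.* k) b)) (combine l r)
      ≡⟨ lookup-relabel σ τ (replicate (k ℕ.* k) b) l r ⟩
    lookup (replicate (k ℕ.* k) b) (combine (σ ⟨$⟩ʳ l) (τ ⟨$⟩ʳ r))
      ≡⟨ lookup-replicate (combine (σ ⟨$⟩ʳ l) (τ ⟨$⟩ʳ r)) b ⟩
    b
      ≡⟨ lookup-replicate (combine l r) b ⟨
    lookup (replicate (k ℕ.* k) b) (combine l r) ∎

  relabel-iso : ∀ σ τ A → BIso (spanning k (relabel σ τ A)) (spanning k A)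
  relabel-iso σ τ A = record
    { σ₁ = σ
    ; σ₂ = τ
    ; preserves = λ l r → begin
        does (combine l r ∈? relabel σ τ A)        ≡⟨ does-∈? (combine l r) (relabel σ τ A) ⟩
        lookup (relabel σ τ A) (combine l r)       ≡⟨ lookup-relabel σ τ A l r ⟩
        lookup A (combine (σ ⟨$⟩ʳ l) (τ ⟨$⟩ʳ r))    ≡⟨ does-∈? _ A ⟨
        does (combine (σ ⟨$⟩ʳ l) (τ ⟨$⟩ʳ r) ∈? A)  ∎
    }

summand : BipartiteProperty → (k : ℕ) → Subset (k ℕ.* k) → ℤ
summand P k A = toℤ (Ψ P (spanning k A)) * sign (k ℕ.* k ∸ ∣ A ∣)

summand-relabel : ∀ P {k} σ τ A → summand P k (relabel σ τ A) ≡ summand P k A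
summand-relabel P {k} σ τ A = cong₂ (λ b c → toℤ b * sign (k ℕ.* k ∸ c))
  (invariant P (relabel-iso σ τ A)) (∣∣-permute (σ ⊗ τ) A)

Ψ-spanning-replicate : ∀ P k b → Ψ P (spanning k (replicate (k ℕ.* k) b)) ≡ Ψ P (bgraph k k (λ _ _ → b))
Ψ-spanning-replicate P k b = invariant P (record
  { σ₁ = Perm.id
  ; σ₂ = Perm.id
  ; preserves = λ l r →
      trans (does-∈? (combine l r) (replicate (k ℕ.* k) b)) (lookup-replicate (combine l r) b)
  })

summand-⊤ : ∀ P k → summand P k ⊤ ≡ toℤ (Ψ P (B k))
summand-⊤ P k = begin
  toℤ (Ψ P (spanning k ⊤)) * sign (k ℕ.* k ∸ ∣ ⊤ {k ℕ.* k} ∣)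
    ≡⟨ cong₂ (λ b m → toℤ b * sign m) (Ψ-spanning-replicate P k true)
             (trans (cong (k ℕ.* k ∸_) (∣⊤∣≡n (k ℕ.* k))) (ℕP.n∸n≡0 (k ℕ.* k))) ⟩
  toℤ (Ψ P (B k)) * + 1
    ≡⟨ ℤP.*-identityʳ _ ⟩
  toℤ (Ψ P (B k)) ∎

summand-⊥ : ∀ P k → summand P k ⊥ ≡ toℤ (Ψ P (I k)) * sign (k ℕ.* k)
summand-⊥ P k =
  cong₂ (λ b m → toℤ b * sign (k ℕ.* k ∸ m)) (Ψ-spanning-replicate P k false) (∣⊥∣≡0 (k ℕ.* k))

∣sign∣≡1 : ∀ m → ℤ.∣ sign m ∣ ≡ 1
∣sign∣≡1 zero    = refl
∣sign∣≡1 (suc m) = trans (ℤP.∣-i∣≡∣i∣ (sign m)) (∣sign∣≡1 m)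

∣toℤ+toℤ*sign∣≡1 : ∀ {b c} → b ≢ c → ∀ m → ℤ.∣ toℤ b + toℤ c * sign m ∣ ≡ 1
∣toℤ+toℤ*sign∣≡1 {true}  {true}  b≢c m = contradiction refl b≢c
∣toℤ+toℤ*sign∣≡1 {true}  {false} _   m = cong (λ z → ℤ.∣ + 1 + z ∣) (ℤP.*-zeroˡ (sign m))
∣toℤ+toℤ*sign∣≡1 {false} {true}  _   m =
  trans (cong ℤ.∣_∣ (trans (ℤP.+-identityˡ _) (ℤP.*-identityˡ (sign m)))) (∣sign∣≡1 m)
∣toℤ+toℤ*sign∣≡1 {false} {false} b≢c m = contradiction refl b≢c

module _ {n : ℕ} where

  rotate : Fin (suc n) → Fin (suc n)
  rotate i = suc (toℕ i) mod suc n

  toℕ-rotate^ : ∀ j i → toℕ ((rotate ^ j) i) ≡ (toℕ i ℕ.+ j) % suc n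
  toℕ-rotate^ zero i = begin
    toℕ i                  ≡⟨ m<n⇒m%n≡m (FinP.toℕ<n i) ⟨
    toℕ i % suc n          ≡⟨ cong (_% suc n) (ℕP.+-identityʳ (toℕ i)) ⟨
    (toℕ i ℕ.+ 0) % suc n  ∎
  toℕ-rotate^ (suc j) i = begin
    toℕ (rotate ((rotate ^ j) i))
      ≡⟨ FinP.toℕ-fromℕ< _ ⟩
    suc (toℕ ((rotate ^ j) i)) % suc n
      ≡⟨ cong (λ m → suc m % suc n) (toℕ-rotate^ j i) ⟩
    suc ((toℕ i ℕ.+ j) % suc n) % suc n
      ≡⟨ %-distribˡ-+ 1 ((toℕ i ℕ.+ j) % suc n) (suc n) ⟩
    (1 % suc n ℕ.+ (toℕ i ℕ.+ j) % suc n % suc n) % suc n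
      ≡⟨ cong (λ m → (1 % suc n ℕ.+ m) % suc n) (m%n%n≡m%n (toℕ i ℕ.+ j) (suc n)) ⟩
    (1 % suc n ℕ.+ (toℕ i ℕ.+ j) % suc n) % suc n
      ≡⟨ %-distribˡ-+ 1 (toℕ i ℕ.+ j) (suc n) ⟨
    suc (toℕ i ℕ.+ j) % suc n
      ≡⟨ cong (_% suc n) (ℕP.+-suc (toℕ i) j) ⟨
    (toℕ i ℕ.+ suc j) % suc n ∎

  rotate^-period : ∀ i → (rotate ^ suc n) i ≡ i
  rotate^-period i = FinP.toℕ-injective (begin
    toℕ ((rotate ^ suc n) i)   ≡⟨ toℕ-rotate^ (suc n) i ⟩
    (toℕ i ℕ.+ suc n) % suc n  ≡⟨ [m+n]%n≡m%n (toℕ i) (suc n) ⟩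
    toℕ i % suc n              ≡⟨ m<n⇒m%n≡m (FinP.toℕ<n i) ⟩
    toℕ i                      ∎)

  rotate^-zero : ∀ i → (rotate ^ toℕ i) Fin.zero ≡ i
  rotate^-zero i = FinP.toℕ-injective (trans (toℕ-rotate^ (toℕ i) Fin.zero) (m<n⇒m%n≡m (FinP.toℕ<n i)))

  rotation : Permutation (suc n) (suc n)
  rotation = periodic⇒↔ rotate {suc n} rotate^-period

module _ (n : ℕ) where

  private
    k : ℕ
    k = suc n

    0ₖ : Fin k
    0ₖ = Fin.zero

  rotL rotR : Subset (k ℕ.* k) → Subset (k ℕ.* k)
  rotL = relabel {k} rotation Perm.id
  rotR = relabel {k} Perm.id rotation

  lookup-rotL^ : ∀ j A (l r : Fin k) →
                 lookup ((rotL ^ j) A) (combine l r) ≡ lookup A (combine ((rotate ^ j) l) r)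
  lookup-rotL^ zero    A l r = refl
  lookup-rotL^ (suc j) A l r = begin
    lookup (rotL ((rotL ^ j) A)) (combine l r)
      ≡⟨ lookup-relabel {k} rotation Perm.id ((rotL ^ j) A) l r ⟩
    lookup ((rotL ^ j) A) (combine (rotate l) r)
      ≡⟨ lookup-rotL^ j A (rotate l) r ⟩
    lookup A (combine ((rotate ^ j) (rotate l)) r)
      ≡⟨ cong (λ l′ → lookup A (combine l′ r)) (^-sucʳ rotate j l) ⟨
    lookup A (combine ((rotate ^ suc j) l) r) ∎

  lookup-rotR^ : ∀ j A (l r : Fin k) →
                 lookup ((rotR ^ j) A) (combine l r) ≡ lookup A (combine l ((rotate ^ j) r))
  lookup-rotR^ zero    A l r = refl
  lookup-rotR^ (suc j) A l r = begin
    lookup (rotR ((rotR ^ j) A)) (combine l r)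
      ≡⟨ lookup-relabel {k} Perm.id rotation ((rotR ^ j) A) l r ⟩
    lookup ((rotR ^ j) A) (combine l (rotate r))
      ≡⟨ lookup-rotR^ j A l (rotate r) ⟩
    lookup A (combine l ((rotate ^ j) (rotate r)))
      ≡⟨ cong (λ r′ → lookup A (combine l r′)) (^-sucʳ rotate j r) ⟨
    lookup A (combine l ((rotate ^ suc j) r)) ∎

  rotL^k≗id : ∀ A → (rotL ^ k) A ≡ A
  rotL^k≗id A = edge-ext λ l r →
    trans (lookup-rotL^ k A l r) (cong (λ l′ → lookup A (combine l′ r)) (rotate^-period l))

  rotR^k≗id : ∀ A → (rotR ^ k) A ≡ A
  rotR^k≗id A = edge-ext λ l r →
    trans (lookup-rotR^ k A l r) (cong (λ r′ → lookup A (combine l r′)) (rotate^-period r))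

  rotL∘rotR≗rotR∘rotL : ∀ A → rotL (rotR A) ≡ rotR (rotL A)
  rotL∘rotR≗rotR∘rotL A = edge-ext λ l r → begin
    lookup (rotL (rotR A)) (combine l r)      ≡⟨ lookup-relabel {k} rotation Perm.id (rotR A) l r ⟩
    lookup (rotR A) (combine (rotate l) r)    ≡⟨ lookup-relabel {k} Perm.id rotation A (rotate l) r ⟩
    lookup A (combine (rotate l) (rotate r))  ≡⟨ lookup-relabel {k} rotation Perm.id A l (rotate r) ⟨
    lookup (rotL A) (combine l (rotate r))    ≡⟨ lookup-relabel {k} Perm.id rotation (rotL A) l r ⟨
    lookup (rotR (rotL A)) (combine l r)      ∎

  rotL-fixed⇒left-irrelevant : ∀ {A} → rotL A ≡ A →
                               ∀ (l r : Fin k) → lookup A (combine l r) ≡ lookup A (combine 0ₖ r)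
  rotL-fixed⇒left-irrelevant {A} rotLA≡A l r = begin
    lookup A (combine l r)
      ≡⟨ cong (λ l′ → lookup A (combine l′ r)) (rotate^-zero l) ⟨
    lookup A (combine ((rotate ^ toℕ l) 0ₖ) r)
      ≡⟨ lookup-rotL^ (toℕ l) A 0ₖ r ⟨
    lookup ((rotL ^ toℕ l) A) (combine 0ₖ r)
      ≡⟨ cong (λ A′ → lookup A′ (combine 0ₖ r)) (fixed⇒^-fixed rotL rotLA≡A (toℕ l)) ⟩
    lookup A (combine 0ₖ r) ∎

  rotR-fixed⇒right-irrelevant : ∀ {A} → rotR A ≡ A →
                                ∀ (l r : Fin k) → lookup A (combine l r) ≡ lookup A (combine l 0ₖ)
  rotR-fixed⇒right-irrelevant {A} rotRA≡A l r = begin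
    lookup A (combine l r)
      ≡⟨ cong (λ r′ → lookup A (combine l r′)) (rotate^-zero r) ⟨
    lookup A (combine l ((rotate ^ toℕ r) 0ₖ))
      ≡⟨ lookup-rotR^ (toℕ r) A l 0ₖ ⟨
    lookup ((rotR ^ toℕ r) A) (combine l 0ₖ)
      ≡⟨ cong (λ A′ → lookup A′ (combine l 0ₖ)) (fixed⇒^-fixed rotR rotRA≡A (toℕ r)) ⟩
    lookup A (combine l 0ₖ) ∎

  rotL-rotR-fixed⇒constant : ∀ {A} → rotL A ≡ A → rotR A ≡ A →
                             A ≡ replicate (k ℕ.* k) (lookup A (combine 0ₖ 0ₖ))
  rotL-rotR-fixed⇒constant {A} rotLA≡A rotRA≡A = edge-ext λ l r → begin
    lookup A (combine l r)    ≡⟨ rotL-fixed⇒left-irrelevant rotLA≡A l r ⟩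
    lookup A (combine 0ₖ r)   ≡⟨ rotR-fixed⇒right-irrelevant rotRA≡A 0ₖ r ⟩
    lookup A (combine 0ₖ 0ₖ)  ≡⟨ lookup-replicate (combine l r) _ ⟨
    lookup (replicate (k ℕ.* k) (lookup A (combine 0ₖ 0ₖ))) (combine l r) ∎

  rotL-rotR-fixed⇒⊤⊎⊥ : ∀ {A} → rotL A ≡ A → rotR A ≡ A → A ≡ ⊤ ⊎ A ≡ ⊥
  rotL-rotR-fixed⇒⊤⊎⊥ {A} rotLA≡A rotRA≡A
    with lookup A (combine 0ₖ 0ₖ) | rotL-rotR-fixed⇒constant rotLA≡A rotRA≡A
  ... | true  | A≡⊤ = inj₁ A≡⊤
  ... | false | A≡⊥ = inj₂ A≡⊥

  replicate-rotL-rotR-fixed : ∀ {A} b → A ≡ replicate (k ℕ.* k) b → rotL A ≡ A × rotR A ≡ A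
  replicate-rotL-rotR-fixed b refl =
    relabel-replicate {k} rotation Perm.id b , relabel-replicate {k} Perm.id rotation b

  ⊤≢⊥ : ⊤ {k ℕ.* k} ≢ ⊥
  ⊤≢⊥ ()

  doublyFixedPart : (Subset (k ℕ.* k) → ℤ) → Subset (k ℕ.* k) → ℤ
  doublyFixedPart F = fixedPart _≟ˢ_ rotR (fixedPart _≟ˢ_ rotL F)

  module _ (F : Subset (k ℕ.* k) → ℤ) where

    F⊤ F⊥ : Subset (k ℕ.* k) → ℤ
    F⊤ = restrict (_≟ˢ ⊤) (const (F ⊤))
    F⊥ = restrict (_≟ˢ ⊥) (const (F ⊥))

    doublyFixedPart-cases : ∀ {A} → Dec (A ≡ ⊤) → Dec (A ≡ ⊥) →
                            doublyFixedPart F A ≡ F⊤ A + F⊥ A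
    doublyFixedPart-cases {A} (yes A≡⊤) _ with replicate-rotL-rotR-fixed true A≡⊤
    ... | rotLA≡A , rotRA≡A = begin
      doublyFixedPart F A  ≡⟨ fixedPart-fixedPart-fixed _≟ˢ_ {rotL} {rotR} {F} rotLA≡A rotRA≡A ⟩
      F A                  ≡⟨ cong F A≡⊤ ⟩
      F ⊤                  ≡⟨ ℤP.+-identityʳ (F ⊤) ⟨
      F ⊤ + 0ℤ             ≡⟨ cong₂ _+_ (restrict-∈ (_≟ˢ ⊤) _ A A≡⊤)
                                        (restrict-∉ (_≟ˢ ⊥) _ A (⊤≢⊥ ∘ trans (sym A≡⊤))) ⟨
      F⊤ A + F⊥ A          ∎
    doublyFixedPart-cases {A} (no A≢⊤) (yes A≡⊥) with replicate-rotL-rotR-fixed false A≡⊥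
    ... | rotLA≡A , rotRA≡A = begin
      doublyFixedPart F A  ≡⟨ fixedPart-fixedPart-fixed _≟ˢ_ {rotL} {rotR} {F} rotLA≡A rotRA≡A ⟩
      F A                  ≡⟨ cong F A≡⊥ ⟩
      F ⊥                  ≡⟨ ℤP.+-identityˡ (F ⊥) ⟨
      0ℤ + F ⊥             ≡⟨ cong₂ _+_ (restrict-∉ (_≟ˢ ⊤) _ A A≢⊤)
                                        (restrict-∈ (_≟ˢ ⊥) _ A A≡⊥) ⟨
      F⊤ A + F⊥ A          ∎
    doublyFixedPart-cases {A} (no A≢⊤) (no A≢⊥) = begin
      doublyFixedPart F A  ≡⟨ fixedPart-fixedPart-moved _≟ˢ_ {rotL} {rotR} {F}
                                (λ (rotLA≡A , rotRA≡A) → [ A≢⊤ , A≢⊥ ]′ (rotL-rotR-fixed⇒⊤⊎⊥ rotLA≡A rotRA≡A)) ⟩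
      0ℤ                   ≡⟨ cong₂ _+_ (restrict-∉ (_≟ˢ ⊤) _ A A≢⊤)
                                        (restrict-∉ (_≟ˢ ⊥) _ A A≢⊥) ⟨
      F⊤ A + F⊥ A          ∎

    ∑-doublyFixedPart : ∑ (enumSubsets (k ℕ.* k)) (doublyFixedPart F) ≡ F ⊤ + F ⊥
    ∑-doublyFixedPart = begin
      ∑ E (doublyFixedPart F)  ≡⟨ ∑-cong E (λ A → doublyFixedPart-cases (A ≟ˢ ⊤) (A ≟ˢ ⊥)) ⟩
      ∑ E (λ A → F⊤ A + F⊥ A)  ≡⟨ ∑-distrib E F⊤ F⊥ ⟩
      ∑ E F⊤ + ∑ E F⊥          ≡⟨ cong₂ _+_ (∑-single E {_≟ˢ_} ⊤ (F ⊤)) (∑-single E {_≟ˢ_} ⊥ (F ⊥)) ⟩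
      F ⊤ + F ⊥                ∎
      where E = enumSubsets (k ℕ.* k)

  aE≡[mod] : Prime k → ∀ P → aE P k ≡ toℤ (Ψ P (B k)) + toℤ (Ψ P (I k)) * sign (k ℕ.* k) [mod k ]
  aE≡[mod] k-prime P =
    ≡-mod-trans (≡-mod-reflexive (sum-allSubsets (k ℕ.* k) F)) (
    ≡-mod-trans left-rotations (
    ≡-mod-trans right-rotations (
    ≡-mod-reflexive (trans (∑-doublyFixedPart F) (cong₂ _+_ (summand-⊤ P k) (summand-⊥ P k))))))
    where
    E = enumSubsets (k ℕ.* k)
    F = summand P k

    left-rotations : ∑ E F ≡ ∑ E (fixedPart _≟ˢ_ rotL F) [mod k ]
    left-rotations = Orbits.∑-fixedPart E _≟ˢ_ k-prime rotL rotL^k≗id (summand-relabel P rotation Perm.id)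

    right-rotations : ∑ E (fixedPart _≟ˢ_ rotL F) ≡ ∑ E (doublyFixedPart F) [mod k ]
    right-rotations = Orbits.∑-fixedPart E _≟ˢ_ k-prime rotR rotR^k≗id
      (fixedPart-invariant _≟ˢ_ {rotL} {rotR} (periodic⇒injective rotR {k} rotR^k≗id) rotL∘rotR≗rotR∘rotL
        (summand-relabel P Perm.id rotation))

lemma20 : (k : ℕ) → Prime k → (P : BipartiteProperty) →
    Ψ P (B k) ≢ Ψ P (I k) → aE P k ≢ + 0
lemma20 zero    k-prime P _         =
  contradiction (ℕ.nonTrivial⇒n>1 0 {{prime⇒nonTrivial k-prime}}) λ ()
lemma20 (suc n) k-prime P Ψ-differs =
  unit-mod⇒≢0 (ℕ.nonTrivial⇒n>1 (suc n) {{prime⇒nonTrivial k-prime}})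
    (∣toℤ+toℤ*sign∣≡1 Ψ-differs (suc n ℕ.* suc n)) (aE≡[mod] n k-prime P)
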